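{- For any tree $T$, ${\rm fdim}(T)={\rm idim}(T)=|E(T)|$.
   Context: All graphs are finite. The $d$-cube $Q_d$ has vertex set $\{0,1\}^d$, two vertices adjacent iff they differ in exactly one coordinate. A Fibonacci string is a binary string with no two consecutive $1$s; the Fibonacci cube $\Gamma_d$ is the subgraph of $Q_d$ induced by the Fibonacci strings of length $d$. ${\rm idim}(G)$ (resp. ${\rm fdim}(G)$) is the least $k$ such that $G$ admits a shortest-path-distance-preserving injective map into $Q_k$ (resp. $\Gamma_k$). -}

module Defs where

open import Data.Nat using (ℕ; zero; suc; _≤_; _<_; _<?_)
open import Data.Bool using (Bool; true; false)
open import Data.Fin using (Fin; toℕ; inject₁; fromℕ)
import Data.Fin as Fin
open import Data.Vec using (Vec; []; _∷_)
open import Data.List using (List; length; filter; cartesianProduct; allFin)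
open import Data.Product using (Σ; _×_; _,_; ∃; proj₁)
open import Data.Empty using (⊥)
open import Data.Unit using (⊤)
open import Relation.Nullary using (¬_; Dec)
open import Relation.Nullary.Decidable using (_×-dec_)
open import Relation.Binary.PropositionalEquality using (_≡_)
open import Function.Definitions using (Injective)
open import Function.Bundles using (_⇔_)

record Graph : Set₁ where
  field
    V   : Set
    Adj : V → V → Set
open Graph public

data Walk (G : Graph) : V G → V G → ℕ → Set where
  here : ∀ {u} → Walk G u u 0
  step : ∀ {u w v ℓ} → Adj G u w → Walk G w v ℓ → Walk G u v (suc ℓ)

-- Shortest-path distance: d is the distance between u and v
-- (no d exists iff u and v lie in different components, i.e. distance ∞)
Dist : (G : Graph) → V G → V G → ℕ → Set
Dist G u v d = Walk G u v d × (∀ ℓ → Walk G u v ℓ → d ≤ ℓ)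

IsometricEmbedding : Graph → Graph → Set
IsometricEmbedding G H =
  Σ (V G → V H) λ f →
    Injective _≡_ _≡_ f ×
    (∀ u v d → Dist G u v d ⇔ Dist H (f u) (f v) d)

hamming : ∀ {k} → Vec Bool k → Vec Bool k → ℕ
hamming [] [] = 0
hamming (true ∷ xs) (false ∷ ys) = suc (hamming xs ys)
hamming (false ∷ xs) (true ∷ ys) = suc (hamming xs ys)
hamming (true ∷ xs) (true ∷ ys) = hamming xs ys
hamming (false ∷ xs) (false ∷ ys) = hamming xs ys

Q : ℕ → Graph
Q k = record { V = Vec Bool k ; Adj = λ x y → hamming x y ≡ 1 }

NoConsecOnes : ∀ {k} → Vec Bool k → Set
NoConsecOnes [] = ⊤
NoConsecOnes (x ∷ []) = ⊤
NoConsecOnes (true ∷ true ∷ xs) = ⊥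
NoConsecOnes (true ∷ false ∷ xs) = NoConsecOnes (false ∷ xs)
NoConsecOnes (false ∷ y ∷ xs) = NoConsecOnes (y ∷ xs)

Γ : ℕ → Graph
Γ k = record { V = Σ (Vec Bool k) NoConsecOnes
             ; Adj = λ x y → hamming (proj₁ x) (proj₁ y) ≡ 1 }

IdimIs : Graph → ℕ → Set
IdimIs G k = IsometricEmbedding G (Q k) × (∀ j → IsometricEmbedding G (Q j) → k ≤ j)

FdimIs : Graph → ℕ → Set
FdimIs G k = IsometricEmbedding G (Γ k) × (∀ j → IsometricEmbedding G (Γ j) → k ≤ j)

record FinGraph (n : ℕ) : Set₁ where
  field
    adj     : Fin n → Fin n → Set
    adj?    : ∀ i j → Dec (adj i j)
    irrefl  : ∀ i → ¬ adj i i
    sym     : ∀ i j → adj i j → adj j i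
open FinGraph public

toGraph : ∀ {n} → FinGraph n → Graph
toGraph {n} G = record { V = Fin n ; Adj = adj G }

edgeCount : ∀ {n} → FinGraph n → ℕ
edgeCount {n} G =
  length (filter (λ p → (toℕ (proj₁ p) <? toℕ (Data.Product.proj₂ p))
                        ×-dec adj? G (proj₁ p) (Data.Product.proj₂ p))
                 (cartesianProduct (allFin n) (allFin n)))

Connected : Graph → Set
Connected G = ∀ u v → ∃ λ ℓ → Walk G u v ℓ

-- A cycle: k = m+3 ≥ 3 distinct vertices c₀,…,c_{k-1} with cᵢ ~ cᵢ₊₁ and c_{k-1} ~ c₀
record Cycle (G : Graph) : Set where
  field
    m      : ℕ
    c      : Fin (suc (suc (suc m))) → V G
    inj    : Injective _≡_ _≡_ c
    consec : ∀ (i : Fin (suc (suc m))) → Adj G (c (inject₁ i)) (c (Fin.suc i))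
    close  : Adj G (c (fromℕ (suc (suc m)))) (c Fin.zero)

Acyclic : Graph → Set
Acyclic G = ¬ Cycle G

IsTree : ∀ {n} → FinGraph n → Set
IsTree G = Connected (toGraph G) × Acyclic (toGraph G)

-- Both Q_k and Γ_k are "down-closed" subgraphs of the hypercube (Γ_k is closed
-- under turning 1s into 0s), so their graph distance is the Hamming distance:
-- walk from x down to the meet x ⊓ y and back up to y.  An isometric embedding
-- into either cube is therefore the same as a Hamming labelling, i.e. a labelling
-- of the vertices by bit strings whose Hamming distances are the graph distances.
--
-- Both bounds are proved by induction on trees, deleting a leaf ℓ with
-- neighbour p.  A leaf avoiding any given vertex exists: a maximal path ends in
-- one, as a further neighbour of its end would close a cycle.  Deleting ℓ keeps
-- a tree, keeps distances and removes exactly one edge.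
--   * Lower bound: the labels of ℓ and p differ in a single coordinate, where
--     every other vertex agrees with p; dropping it labels T − ℓ.
--   * Upper bound: a Fibonacci labelling of T − ℓ in which p has room for a 1
--     extends by one coordinate (1 at ℓ, 0 elsewhere), and the new zero column
--     leaves room for a 1 at any other chosen root.
module Submission where

open import Defs
open import Data.Bool using (Bool; true; false; _∧_)
import Data.Bool as Bool
import Data.Bool.Properties as Boolₚ
open import Data.Fin using (Fin; zero; suc; toℕ; inject₁; fromℕ; punchIn; punchOut)
open import Data.Fin.Properties
  using (_≟_; any?; injective⇒≤; toℕ-injective; punchInᵢ≢i; punchIn-injective;
         punchIn-punchOut; punchIn-mono-≤; punchIn-cancel-≤)
open import Data.List using (List; length; filter; map; tabulate; allFin; cartesianProduct; _++_)
open import Data.List.Properties using (filter-++; length-++; map-tabulate)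
open import Data.Nat using (ℕ; zero; suc; _+_; _≤_; _<_; z≤n; s≤s; _<?_)
open import Data.Nat.Properties
  using (≤-refl; ≤-reflexive; ≤-trans; ≤-antisym; ≤-pred; <-irrefl; <-cmp; <⇒≱; ≰⇒>;
         n≤1+n; 1+n≰n; +-mono-≤; +-suc; +-identityʳ; +-assoc; +-cancelʳ-≡; suc-injective;
         +-0-commutativeMonoid; +-commutativeSemigroup; module ≤-Reasoning)
open import Algebra.Properties.CommutativeMonoid.Sum +-0-commutativeMonoid
  using (sum; sum-syntax; sum-remove; ∑-distrib-+; sum-cong-≗; sum-replicate-zero)
open import Algebra.Properties.CommutativeSemigroup +-commutativeSemigroup
  using (interchange; x∙yz≈y∙xz)
open import Data.Product using (Σ; _×_; _,_; proj₁; proj₂)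
open import Data.Product.Function.NonDependent.Propositional using (_×-⇔_)
open import Data.Sum using (_⊎_; inj₁; inj₂; [_,_])
open import Data.Unit using (⊤; tt)
open import Data.Vec using (Vec; []; _∷_; zipWith; insertAt; removeAt; lookup)
open import Data.Vec.Properties using (insertAt-removeAt)
open import Data.Vec.Relation.Binary.Pointwise.Inductive using (Pointwise; []; _∷_)
import Data.Vec.Relation.Binary.Pointwise.Inductive as Pointwise
open import Function.Base using (_∘_; id)
open import Function.Bundles using (_⇔_; mk⇔; Equivalence)
import Function.Construct.Identity as Identity
open import Function.Definitions using (Injective)
open import Relation.Binary.Definitions using (tri<; tri≈; tri>)
open import Relation.Binary.PropositionalEquality
  using (_≡_; _≢_; refl; trans; cong; cong₂; subst; subst₂; module ≡-Reasoning)
import Relation.Binary.PropositionalEquality as ≡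
open import Relation.Nullary using (¬_; Dec; yes; no; contradiction; ¬?; Irrelevant)
open import Relation.Nullary.Decidable using (_×-dec_; _⊎-dec_; decidable-stable)
open import Relation.Unary using (Decidable)

module _ {G : Graph} where

  _++ʷ_ : ∀ {u w v a b} → Walk G u w a → Walk G w v b → Walk G u v (a + b)
  here ++ʷ q = q
  step e p ++ʷ q = step e (p ++ʷ q)

  snoc : ∀ {u w v a} → Walk G u w a → Adj G w v → Walk G u v (suc a)
  snoc here e = step e here
  snoc (step e' p) e = step e' (snoc p e)

  reverse : (∀ {x y} → Adj G x y → Adj G y x) → ∀ {u v a} → Walk G u v a → Walk G v u a
  reverse s here = here
  reverse s (step e p) = snoc (reverse s p) (s e)

  dist-refl : ∀ {u} → Dist G u u 0
  dist-refl = here , λ _ _ → z≤n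

  dist-zero : ∀ {u v} → Dist G u v 0 → u ≡ v
  dist-zero (here , _) = refl

  dist-unique : ∀ {u v d d′} → Dist G u v d → Dist G u v d′ → d ≡ d′
  dist-unique (w , min) (w′ , min′) = ≤-antisym (min _ w′) (min′ _ w)

  dist-sym : (∀ {x y} → Adj G x y → Adj G y x) → ∀ {u v d} → Dist G u v d → Dist G v u d
  dist-sym s (w , min) = reverse s w , λ ℓ w′ → min ℓ (reverse s w′)

dif : Bool → Bool → ℕ
dif false false = 0
dif false true  = 1
dif true  false = 1
dif true  true  = 0

hamming-∷ : ∀ {k} a b (x y : Vec Bool k) → hamming (a ∷ x) (b ∷ y) ≡ dif a b + hamming x y
hamming-∷ false false x y = refl
hamming-∷ false true  x y = refl
hamming-∷ true  false x y = refl
hamming-∷ true  true  x y = refl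

hamming-∷-same : ∀ {k} a (x y : Vec Bool k) → hamming (a ∷ x) (a ∷ y) ≡ hamming x y
hamming-∷-same false x y = refl
hamming-∷-same true  x y = refl

hamming-self : ∀ {k} (x : Vec Bool k) → hamming x x ≡ 0
hamming-self [] = refl
hamming-self (a ∷ x) = trans (hamming-∷-same a x x) (hamming-self x)

hamming-sym : ∀ {k} (x y : Vec Bool k) → hamming x y ≡ hamming y x
hamming-sym [] [] = refl
hamming-sym (false ∷ x) (false ∷ y) = hamming-sym x y
hamming-sym (false ∷ x) (true  ∷ y) = cong suc (hamming-sym x y)
hamming-sym (true  ∷ x) (false ∷ y) = cong suc (hamming-sym x y)
hamming-sym (true  ∷ x) (true  ∷ y) = hamming-sym x y

hamming-zero : ∀ {k} (x y : Vec Bool k) → hamming x y ≡ 0 → x ≡ y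
hamming-zero [] [] _ = refl
hamming-zero (false ∷ x) (false ∷ y) e = cong (false ∷_) (hamming-zero x y e)
hamming-zero (true  ∷ x) (true  ∷ y) e = cong (true ∷_) (hamming-zero x y e)

dif-triangle : ∀ a b c → dif a c ≤ dif a b + dif b c
dif-triangle false false false = z≤n
dif-triangle false false true  = s≤s z≤n
dif-triangle false true  false = z≤n
dif-triangle false true  true  = s≤s z≤n
dif-triangle true  false false = s≤s z≤n
dif-triangle true  false true  = z≤n
dif-triangle true  true  false = s≤s z≤n
dif-triangle true  true  true  = z≤n

hamming-triangle : ∀ {k} (x y z : Vec Bool k) → hamming x z ≤ hamming x y + hamming y z
hamming-triangle [] [] [] = z≤n
hamming-triangle (a ∷ x) (b ∷ y) (c ∷ z) = begin
  hamming (a ∷ x) (c ∷ z)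
    ≡⟨ hamming-∷ a c x z ⟩
  dif a c + hamming x z
    ≤⟨ +-mono-≤ (dif-triangle a b c) (hamming-triangle x y z) ⟩
  (dif a b + dif b c) + (hamming x y + hamming y z)
    ≡⟨ interchange (dif a b) (dif b c) (hamming x y) (hamming y z) ⟩
  (dif a b + hamming x y) + (dif b c + hamming y z)
    ≡⟨ ≡.sym (cong₂ _+_ (hamming-∷ a b x y) (hamming-∷ b c y z)) ⟩
  hamming (a ∷ x) (b ∷ y) + hamming (b ∷ y) (c ∷ z) ∎
  where open ≤-Reasoning

dif-self : ∀ a → dif a a ≡ 0
dif-self false = refl
dif-self true  = refl

dif-step : ∀ a b c → dif a c ≡ suc (dif b c) → b ≡ c
dif-step a     false false _ = refl
dif-step a     true  true  _ = refl
dif-step false false true  ()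
dif-step true  false true  ()
dif-step false true  false ()
dif-step true  true  false ()

hamming-insertAt : ∀ {k} (x y : Vec Bool k) i a b →
  hamming (insertAt x i a) (insertAt y i b) ≡ dif a b + hamming x y
hamming-insertAt x y zero a b = hamming-∷ a b x y
hamming-insertAt (c ∷ x) (d ∷ y) (suc i) a b = begin
  hamming (c ∷ insertAt x i a) (d ∷ insertAt y i b) ≡⟨ hamming-∷ c d _ _ ⟩
  dif c d + hamming (insertAt x i a) (insertAt y i b) ≡⟨ cong (dif c d +_) (hamming-insertAt x y i a b) ⟩
  dif c d + (dif a b + hamming x y)                 ≡⟨ x∙yz≈y∙xz (dif c d) (dif a b) (hamming x y) ⟩
  dif a b + (dif c d + hamming x y)                 ≡⟨ cong (dif a b +_) (≡.sym (hamming-∷ c d x y)) ⟩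
  dif a b + hamming (c ∷ x) (d ∷ y)                 ∎
  where open ≡-Reasoning

hamming-removeAt : ∀ {k} (x y : Vec Bool (suc k)) c →
  hamming x y ≡ dif (lookup x c) (lookup y c) + hamming (removeAt x c) (removeAt y c)
hamming-removeAt x y c =
  trans (≡.sym (cong₂ hamming (insertAt-removeAt x c) (insertAt-removeAt y c)))
        (hamming-insertAt (removeAt x c) (removeAt y c) c (lookup x c) (lookup y c))

hamming-one : ∀ {k} (x y : Vec Bool (suc k)) → hamming x y ≡ 1 →
  Σ (Fin (suc k)) λ c → removeAt x c ≡ removeAt y c
hamming-one (false ∷ x) (true  ∷ y) e = zero , hamming-zero x y (suc-injective e)
hamming-one (true  ∷ x) (false ∷ y) e = zero , hamming-zero x y (suc-injective e)
hamming-one (false ∷ []) (false ∷ []) ()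
hamming-one (true  ∷ []) (true  ∷ []) ()
hamming-one (false ∷ x@(_ ∷ _)) (false ∷ y@(_ ∷ _)) e with c , x≡y ← hamming-one x y e =
  suc c , cong (false ∷_) x≡y
hamming-one (true ∷ x@(_ ∷ _)) (true ∷ y@(_ ∷ _)) e with c , x≡y ← hamming-one x y e =
  suc c , cong (true ∷_) x≡y

-- Down-closed subgraphs of the hypercube: their distance is the Hamming distance.

infix 4 _⊑_
_⊑_ : ∀ {k} → Vec Bool k → Vec Bool k → Set
_⊑_ = Pointwise Bool._≤_

⊑-refl : ∀ {k} {x : Vec Bool k} → x ⊑ x
⊑-refl = Pointwise.refl Boolₚ.≤-refl

infixl 7 _⊓_
_⊓_ : ∀ {k} → Vec Bool k → Vec Bool k → Vec Bool k
_⊓_ = zipWith _∧_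

⊓-⊑ˡ : ∀ {k} (x y : Vec Bool k) → x ⊓ y ⊑ x
⊓-⊑ˡ [] [] = []
⊓-⊑ˡ (false ∷ x) (b     ∷ y) = Bool.b≤b ∷ ⊓-⊑ˡ x y
⊓-⊑ˡ (true  ∷ x) (false ∷ y) = Bool.f≤t ∷ ⊓-⊑ˡ x y
⊓-⊑ˡ (true  ∷ x) (true  ∷ y) = Bool.b≤b ∷ ⊓-⊑ˡ x y

⊓-⊑ʳ : ∀ {k} (x y : Vec Bool k) → x ⊓ y ⊑ y
⊓-⊑ʳ [] [] = []
⊓-⊑ʳ (false ∷ x) (false ∷ y) = Bool.b≤b ∷ ⊓-⊑ʳ x y
⊓-⊑ʳ (false ∷ x) (true  ∷ y) = Bool.f≤t ∷ ⊓-⊑ʳ x y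
⊓-⊑ʳ (true  ∷ x) (b     ∷ y) = Bool.b≤b ∷ ⊓-⊑ʳ x y

hamming-via-⊓ : ∀ {k} (x y : Vec Bool k) → hamming x y ≡ hamming x (x ⊓ y) + hamming (x ⊓ y) y
hamming-via-⊓ [] [] = refl
hamming-via-⊓ (false ∷ x) (false ∷ y) = hamming-via-⊓ x y
hamming-via-⊓ (false ∷ x) (true  ∷ y) = trans (cong suc (hamming-via-⊓ x y)) (≡.sym (+-suc _ _))
hamming-via-⊓ (true  ∷ x) (false ∷ y) = cong suc (hamming-via-⊓ x y)
hamming-via-⊓ (true  ∷ x) (true  ∷ y) = hamming-via-⊓ x y

descend : ∀ {k} {x y : Vec Bool k} {h} → y ⊑ x → hamming x y ≡ suc h →
  Σ (Vec Bool k) λ z → (y ⊑ z × z ⊑ x) × hamming x z ≡ 1 × hamming z y ≡ h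
descend {x = true ∷ x} {false ∷ y} (Bool.f≤t ∷ y⊑x) e =
  false ∷ x , (Bool.b≤b ∷ y⊑x , Bool.f≤t ∷ ⊑-refl) , cong suc (hamming-self x) , suc-injective e
descend {x = a ∷ x} {.a ∷ y} (Bool.b≤b ∷ y⊑x) e
  with z , (y⊑z , z⊑x) , xz , zy ← descend y⊑x (trans (≡.sym (hamming-∷-same a x y)) e) =
  a ∷ z , (Bool.b≤b ∷ y⊑z , Bool.b≤b ∷ z⊑x) ,
  trans (hamming-∷-same a x z) xz , trans (hamming-∷-same a z y) zy

SubCube : (k : ℕ) → (Vec Bool k → Set) → Graph
SubCube k P = record { V = Σ (Vec Bool k) P ; Adj = λ x y → hamming (proj₁ x) (proj₁ y) ≡ 1 }

DownClosed : ∀ {k} → (Vec Bool k → Set) → Set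
DownClosed P = ∀ {x y} → x ⊑ y → P y → P x

hamming-≤-length : ∀ {G : Graph} {k} (lab : V G → Vec Bool k) →
  (∀ {x y} → Adj G x y → hamming (lab x) (lab y) ≡ 1) →
  ∀ {x y L} → Walk G x y L → hamming (lab x) (lab y) ≤ L
hamming-≤-length lab adj⇒1 {x} here = ≤-reflexive (hamming-self (lab x))
hamming-≤-length lab adj⇒1 {x} {y} (step {w = w} e p) = begin
  hamming (lab x) (lab y)                       ≤⟨ hamming-triangle (lab x) (lab w) (lab y) ⟩
  hamming (lab x) (lab w) + hamming (lab w) (lab y) ≡⟨ cong (_+ _) (adj⇒1 e) ⟩
  suc (hamming (lab w) (lab y))                 ≤⟨ s≤s (hamming-≤-length lab adj⇒1 p) ⟩
  suc _                                         ∎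
  where open ≤-Reasoning

module _ {k} {P : Vec Bool k → Set} (down : DownClosed P) (irr : ∀ x → Irrelevant (P x)) where

  private
    Cube = SubCube k P

  walk-down : ∀ h (x y : V Cube) → proj₁ y ⊑ proj₁ x →
    hamming (proj₁ x) (proj₁ y) ≡ h → Walk Cube x y h
  walk-down zero (x , px) (y , py) _ e with refl ← hamming-zero x y e
    rewrite irr x px py = here
  walk-down (suc h) (x , px) y y⊑x e
    with z , (y⊑z , z⊑x) , xz , zy ← descend y⊑x e =
    step xz (walk-down h (z , down z⊑x px) y y⊑z zy)

  -- In a down-closed subcube, go down from x to x ⊓ y and then up to y.
  subCube-walk : (x y : V Cube) → Walk Cube x y (hamming (proj₁ x) (proj₁ y))
  subCube-walk (x , px) (y , py) =
    subst (Walk Cube (x , px) (y , py)) (≡.sym length-eq)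
      (walk-down _ (x , px) m (⊓-⊑ˡ x y) refl ++ʷ
       reverse (λ {a} {b} e → trans (hamming-sym (proj₁ b) (proj₁ a)) e)
               (walk-down _ (y , py) m (⊓-⊑ʳ x y) refl))
    where
    m = x ⊓ y , down (⊓-⊑ˡ x y) px
    length-eq : hamming x y ≡ hamming x (x ⊓ y) + hamming y (x ⊓ y)
    length-eq = trans (hamming-via-⊓ x y) (cong (hamming x (x ⊓ y) +_) (hamming-sym (x ⊓ y) y))

HammingMetric : (H : Graph) {k : ℕ} → (V H → Vec Bool k) → Set
HammingMetric H lab = ∀ x y d → Dist H x y d ⇔ hamming (lab x) (lab y) ≡ d

hammingMetric : ∀ {H : Graph} {k} (lab : V H → Vec Bool k) →
  (∀ {x y} → Adj H x y → hamming (lab x) (lab y) ≡ 1) →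
  (∀ x y → Walk H x y (hamming (lab x) (lab y))) → HammingMetric H lab
hammingMetric {H} lab adj⇒1 walk x y d = mk⇔ (λ D → dist-unique geodesic D) (λ { refl → geodesic })
  where
  geodesic : Dist H x y (hamming (lab x) (lab y))
  geodesic = walk x y , λ _ w → hamming-≤-length lab adj⇒1 w

subCube-metric : ∀ {k} {P : Vec Bool k → Set} → DownClosed P → (∀ x → Irrelevant (P x)) →
  HammingMetric (SubCube k P) proj₁
subCube-metric down irr = hammingMetric proj₁ (λ e → e) (subCube-walk down irr)

forget : ∀ {k} {P : Vec Bool k → Set} {x y L} →
  Walk (SubCube k P) x y L → Walk (Q k) (proj₁ x) (proj₁ y) L
forget here = here
forget (step e w) = step e (forget w)

-- Distances in Q_k are Hamming distances (Q_k is the subcube of the trivial property).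
Q-metric : ∀ {k} → HammingMetric (Q k) id
Q-metric = hammingMetric id (λ e → e)
  (λ x y → forget (subCube-walk {P = λ _ → ⊤} (λ _ _ → tt) (λ _ _ _ → refl) (x , tt) (y , tt)))

noConsecOnes-irrelevant : ∀ {k} (x : Vec Bool k) → Irrelevant (NoConsecOnes x)
noConsecOnes-irrelevant [] tt tt = refl
noConsecOnes-irrelevant (a ∷ []) tt tt = refl
noConsecOnes-irrelevant (true ∷ false ∷ x) p q = noConsecOnes-irrelevant (false ∷ x) p q
noConsecOnes-irrelevant (false ∷ b ∷ x) p q = noConsecOnes-irrelevant (b ∷ x) p q

noConsecOnes-tail : ∀ {k} a (x : Vec Bool k) → NoConsecOnes (a ∷ x) → NoConsecOnes x
noConsecOnes-tail a [] _ = tt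
noConsecOnes-tail false (b ∷ x) n = n
noConsecOnes-tail true (false ∷ x) n = n

noConsecOnes-false∷ : ∀ {k} (x : Vec Bool k) → NoConsecOnes x → NoConsecOnes (false ∷ x)
noConsecOnes-false∷ [] _ = tt
noConsecOnes-false∷ (b ∷ x) n = n

noConsecOnes-down : ∀ {k} → DownClosed (NoConsecOnes {k})
noConsecOnes-down [] _ = tt
noConsecOnes-down (_ ∷ []) _ = tt
noConsecOnes-down {x = false ∷ x} {_ ∷ y} (_ ∷ x⊑y) n =
  noConsecOnes-false∷ x (noConsecOnes-down x⊑y (noConsecOnes-tail _ y n))
noConsecOnes-down {x = true ∷ true ∷ _} (Bool.b≤b ∷ Bool.b≤b ∷ _) ()
noConsecOnes-down {x = true ∷ false ∷ _} {true ∷ false ∷ _} (Bool.b≤b ∷ _ ∷ x⊑y) n =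
  noConsecOnes-down (Bool.b≤b ∷ x⊑y) n

Γ-metric : ∀ {k} → HammingMetric (Γ k) proj₁
Γ-metric = subCube-metric noConsecOnes-down noConsecOnes-irrelevant

insert-false : ∀ {k} (x : Vec Bool k) i → NoConsecOnes x → NoConsecOnes (insertAt x i false)
insert-false x zero n = noConsecOnes-false∷ x n
insert-false (false ∷ x) (suc i) n =
  noConsecOnes-false∷ (insertAt x i false) (insert-false x i (noConsecOnes-tail false x n))
insert-false (true ∷ x) (suc zero) n = noConsecOnes-false∷ x (noConsecOnes-tail true x n)
insert-false (true ∷ false ∷ x) (suc (suc i)) n = insert-false (false ∷ x) (suc i) n

HasSlot : ∀ {k} → Vec Bool k → Set
HasSlot {k} x = Σ (Fin (suc k)) λ j → NoConsecOnes (insertAt x j true)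

insert-false-slot : ∀ {k} (x : Vec Bool k) i → NoConsecOnes x → HasSlot (insertAt x i false)
insert-false-slot x zero n = zero , noConsecOnes-false∷ x n
insert-false-slot (false ∷ x) (suc i) n
  with j , slot ← insert-false-slot x i (noConsecOnes-tail false x n) =
  suc j , noConsecOnes-false∷ (insertAt (insertAt x i false) j true) slot
insert-false-slot (true ∷ x) (suc zero) n = suc (suc zero) , n
insert-false-slot (true ∷ false ∷ x) (suc (suc i)) n
  with j , slot ← insert-false-slot x i (noConsecOnes-tail false x n) =
  suc (suc j) , noConsecOnes-false∷ (insertAt (insertAt x i false) j true) slot

IsHammingLabelling : (G : Graph) {k : ℕ} → (V G → Vec Bool k) → Set
IsHammingLabelling G F = ∀ u v → Dist G u v (hamming (F u) (F v))

module _ {G H : Graph} {k} (lab : V H → Vec Bool k) (metric : HammingMetric H lab) where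

  embedding⇒labelling : IsometricEmbedding G H → Σ (V G → Vec Bool k) (IsHammingLabelling G)
  embedding⇒labelling (f , _ , iso) =
    lab ∘ f , λ u v → Equivalence.from (iso u v _) (Equivalence.from (metric _ _ _) refl)

  -- Conversely a map with a Hamming labelling is an isometric embedding; it is
  -- injective because distinct vertices are at positive distance.
  labelling⇒embedding : (f : V G → V H) → IsHammingLabelling G (lab ∘ f) → IsometricEmbedding G H
  labelling⇒embedding f F = f , injective , λ u v d → mk⇔
    (λ D → subst (Dist H (f u) (f v)) (dist-unique (F u v) D) (Equivalence.from (metric _ _ _) refl))
    (λ D → subst (Dist G u v) (Equivalence.to (metric _ _ _) D) (F u v))
    where
    injective : ∀ {u v} → f u ≡ f v → u ≡ v
    injective {u} {v} fu≡fv = dist-zero (subst (Dist G u v) labels-equal (F u v))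
      where
      labels-equal : hamming (lab (f u)) (lab (f v)) ≡ 0
      labels-equal = trans (cong (λ z → hamming (lab (f u)) (lab z)) (≡.sym fu≡fv)) (hamming-self (lab (f u)))

module _ {G : Graph} where

  _∈ʷ_ : ∀ {u v L} → V G → Walk G u v L → Set
  _∈ʷ_ {u} x here = x ≡ u
  _∈ʷ_ {u} x (step e w) = x ≡ u ⊎ x ∈ʷ w

  IsPath : ∀ {u v L} → Walk G u v L → Set
  IsPath here = ⊤
  IsPath {u} (step e w) = ¬ u ∈ʷ w × IsPath w

  end-∈ : ∀ {u v L} (w : Walk G u v L) → v ∈ʷ w
  end-∈ here = refl
  end-∈ (step e w) = inj₂ (end-∈ w)

  prefix : ∀ {u v L} (w : Walk G u v L) {x} → x ∈ʷ w →
    Σ ℕ λ a → Σ (Walk G u x a) λ w′ → (∀ {y} → y ∈ʷ w′ → y ∈ʷ w) × (IsPath w → IsPath w′)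
  prefix here refl = 0 , here , (λ y∈ → y∈) , (λ _ → tt)
  prefix (step e w) (inj₁ refl) = 0 , here , inj₁ , (λ _ → tt)
  prefix (step e w) (inj₂ x∈w) with a , w′ , w′⊆w , path ← prefix w x∈w =
    suc a , step e w′ , [ inj₁ , inj₂ ∘ w′⊆w ] , λ (u∉w , path-w) → u∉w ∘ w′⊆w , path path-w

  vertexAt : ∀ {u v L} → Walk G u v L → Fin (suc L) → V G
  vertexAt {u} here _ = u
  vertexAt {u} (step e w) zero = u
  vertexAt (step e w) (suc i) = vertexAt w i

  vertexAt-∈ : ∀ {u v L} (w : Walk G u v L) i → vertexAt w i ∈ʷ w
  vertexAt-∈ here i = refl
  vertexAt-∈ (step e w) zero = inj₁ refl
  vertexAt-∈ (step e w) (suc i) = inj₂ (vertexAt-∈ w i)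

  vertexAt-injective : ∀ {u v L} (w : Walk G u v L) → IsPath w → Injective _≡_ _≡_ (vertexAt w)
  vertexAt-injective here _ {zero} {zero} _ = refl
  vertexAt-injective (step e w) _ {zero} {zero} _ = refl
  vertexAt-injective (step e w) (u∉w , _) {zero} {suc j} u≡ =
    contradiction (subst (_∈ʷ w) (≡.sym u≡) (vertexAt-∈ w j)) u∉w
  vertexAt-injective (step e w) (u∉w , _) {suc i} {zero} ≡u =
    contradiction (subst (_∈ʷ w) ≡u (vertexAt-∈ w i)) u∉w
  vertexAt-injective (step e w) (_ , path) {suc i} {suc j} eq = cong suc (vertexAt-injective w path eq)

  vertexAt-first : ∀ {u v L} (w : Walk G u v L) → vertexAt w zero ≡ u
  vertexAt-first here = refl
  vertexAt-first (step e w) = refl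

  vertexAt-last : ∀ {u v L} (w : Walk G u v L) → vertexAt w (fromℕ L) ≡ v
  vertexAt-last here = refl
  vertexAt-last (step e w) = vertexAt-last w

  vertexAt-edge : ∀ {u v L} (w : Walk G u v (suc L)) (i : Fin (suc L)) →
    Adj G (vertexAt w (inject₁ i)) (vertexAt w (suc i))
  vertexAt-edge (step e w) zero = subst (Adj G _) (≡.sym (vertexAt-first w)) e
  vertexAt-edge (step e (step e′ w)) (suc i) = vertexAt-edge (step e′ w) i

  path-cycle : ∀ {u v m} (w : Walk G u v (suc (suc m))) → IsPath w → Adj G v u → Cycle G
  path-cycle {m = m} w path vu = record
    { m = m
    ; c = vertexAt w
    ; inj = vertexAt-injective w path
    ; consec = vertexAt-edge w
    ; close = subst₂ (Adj G) (≡.sym (vertexAt-last w)) (≡.sym (vertexAt-first w)) vu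
    }

  chord : ∀ {u p v L} (e : Adj G u p) (w : Walk G p v L) → IsPath (step e w) →
    ∀ {x} → x ∈ʷ w → Adj G x u → x ≡ p ⊎ Cycle G
  chord e w (u∉w , path-w) x∈w xu with prefix w x∈w
  ... | zero , here , _ , _ = inj₁ refl
  ... | suc a , step e′ w′ , w′⊆w , path-w′ =
    inj₂ (path-cycle (step e (step e′ w′)) (u∉w ∘ w′⊆w , path-w′ path-w) xu)

-- A leaf ℓ of T; its unique neighbour is given by its index p in T − ℓ.
record Leaf {n} (T : FinGraph (suc n)) : Set where
  field
    ℓ      : Fin (suc n)
    p      : Fin n
    edge   : adj T ℓ (punchIn ℓ p)
    unique : ∀ x → adj T ℓ x → x ≡ punchIn ℓ p

module _ {n} (T : FinGraph (suc n)) (acyclic : Acyclic (toGraph T)) where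

  private
    G = toGraph T

  _∈ʷ?_ : ∀ {u v L} x (w : Walk G u v L) → Dec (x ∈ʷ w)
  x ∈ʷ? here = x ≟ _
  x ∈ʷ? step e w = (x ≟ _) ⊎-dec (x ∈ʷ? w)

  path-length : ∀ {u v L} (w : Walk G u v L) → IsPath w → suc L ≤ suc n
  path-length w path = injective⇒≤ (vertexAt-injective w path)

  -- Grow a path ending at q from its other end until that end has no new
  -- neighbour; by acyclicity that end is then a leaf.  Since a path has at most
  -- n + 1 vertices, the fuel n − L suffices.
  grow-path : ∀ fuel {q v L} (w : Walk G v q (suc L)) → IsPath w → n ≤ L + fuel →
    Σ (Leaf T) λ leaf → Leaf.ℓ leaf ≢ q
  grow-path zero {L = L} w path bound =
    contradiction (≤-trans (≤-pred (path-length w path)) (≤-trans bound (≤-reflexive (+-identityʳ L)))) 1+n≰n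
  grow-path (suc fuel) {v = v} {L} w@(step {w = p} e w′) path bound
    with any? (λ x → adj? T v x ×-dec ¬? (x ∈ʷ? w))
  ... | yes (x , vx , x∉w) =
    grow-path fuel (step (sym T v x vx) w) (x∉w , path) (≤-trans bound (≤-reflexive (+-suc L fuel)))
  ... | no no-new-neighbour = record { ℓ = v ; p = punchOut v≢p ; edge = edge ; unique = unique } , v≢q
    where
    v≢p : v ≢ p
    v≢p v≡p = irrefl T v (subst (adj T v) (≡.sym v≡p) e)
    edge : adj T v (punchIn v (punchOut v≢p))
    edge = subst (adj T v) (≡.sym (punchIn-punchOut v≢p)) e
    unique : ∀ x → adj T v x → x ≡ punchIn v (punchOut v≢p)
    unique x vx with decidable-stable (x ∈ʷ? w) (λ x∉w → no-new-neighbour (x , vx , x∉w))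
    ... | inj₁ refl = contradiction vx (irrefl T v)
    ... | inj₂ x∈w′ with chord e w′ path x∈w′ (sym T v x vx)
    ...   | inj₁ x≡p = trans x≡p (≡.sym (punchIn-punchOut v≢p))
    ...   | inj₂ cycle = contradiction cycle acyclic
    v≢q : v ≢ _
    v≢q refl = proj₁ path (end-∈ w′)

another-vertex : ∀ {k} (q : Fin (suc (suc k))) → Σ (Fin (suc (suc k))) λ w → w ≢ q
another-vertex zero = suc zero , λ ()
another-vertex (suc _) = zero , λ ()

leaf-avoiding : ∀ {k} (T : FinGraph (suc (suc k))) → IsTree T → (q : Fin (suc (suc k))) →
  Σ (Leaf T) λ leaf → Leaf.ℓ leaf ≢ q
leaf-avoiding {k} T (connected , acyclic) q with w , w≢q ← another-vertex q =
  first-step w≢q (proj₂ (connected q w))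
  where
  first-step : ∀ {w L} → w ≢ q → Walk (toGraph T) q w L → Σ (Leaf T) λ leaf → Leaf.ℓ leaf ≢ q
  first-step w≢q here = contradiction refl w≢q
  first-step _ (step {w = x} qx _) =
    grow-path T acyclic (suc k) (step (sym T q x qx) here)
      ((λ x≡q → irrefl T q (subst (adj T q) x≡q qx)) , tt) ≤-refl

-- The graph G − ℓ, its vertices renumbered through punchIn ℓ.
deleteVertex : ∀ {n} → FinGraph (suc n) → Fin (suc n) → FinGraph n
deleteVertex G ℓ = record
  { adj    = λ i j → adj G (punchIn ℓ i) (punchIn ℓ j)
  ; adj?   = λ i j → adj? G (punchIn ℓ i) (punchIn ℓ j)
  ; irrefl = λ i → irrefl G (punchIn ℓ i)
  ; sym    = λ i j → sym G (punchIn ℓ i) (punchIn ℓ j)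
  }

data Punched {n} (ℓ : Fin (suc n)) : Fin (suc n) → Set where
  hole : Punched ℓ ℓ
  kept : (u : Fin n) → Punched ℓ (punchIn ℓ u)

punched : ∀ {n} (ℓ x : Fin (suc n)) → Punched ℓ x
punched ℓ x with ℓ ≟ x
... | yes refl = hole
... | no ℓ≢x = subst (Punched ℓ) (punchIn-punchOut ℓ≢x) (kept (punchOut ℓ≢x))

lift-walk : ∀ {n} (G : FinGraph (suc n)) ℓ {u v L} →
  Walk (toGraph (deleteVertex G ℓ)) u v L → Walk (toGraph G) (punchIn ℓ u) (punchIn ℓ v) L
lift-walk G ℓ here = here
lift-walk G ℓ (step e w) = step e (lift-walk G ℓ w)

acyclic-delete : ∀ {n} (G : FinGraph (suc n)) ℓ → Acyclic (toGraph G) → Acyclic (toGraph (deleteVertex G ℓ))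
acyclic-delete G ℓ acyclic C = acyclic record
  { m = Cycle.m C
  ; c = punchIn ℓ ∘ Cycle.c C
  ; inj = Cycle.inj C ∘ punchIn-injective ℓ _ _
  ; consec = Cycle.consec C
  ; close = Cycle.close C
  }

indicator : ∀ {A : Set} → Dec A → ℕ
indicator (yes _) = 1
indicator (no _)  = 0

indicator-yes : ∀ {A : Set} → A → (a? : Dec A) → indicator a? ≡ 1
indicator-yes a (yes _) = refl
indicator-yes a (no ¬a) = contradiction a ¬a

indicator-no : ∀ {A : Set} → ¬ A → (a? : Dec A) → indicator a? ≡ 0
indicator-no ¬a (yes a) = contradiction a ¬a
indicator-no ¬a (no _)  = refl

indicator-⇔ : ∀ {A B : Set} → A ⇔ B → (a? : Dec A) (b? : Dec B) → indicator a? ≡ indicator b?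
indicator-⇔ A⇔B (yes a) b? = ≡.sym (indicator-yes (Equivalence.to A⇔B a) b?)
indicator-⇔ A⇔B (no ¬a) b? = ≡.sym (indicator-no (¬a ∘ Equivalence.from A⇔B) b?)

length-filter-tabulate : ∀ {A : Set} {P : A → Set} (P? : Decidable P) {n} (h : Fin n → A) →
  length (filter P? (tabulate h)) ≡ ∑[ i < n ] indicator (P? (h i))
length-filter-tabulate P? {zero} h = refl
length-filter-tabulate P? {suc n} h with P? (h zero)
... | yes _ = cong suc (length-filter-tabulate P? (h ∘ suc))
... | no _  = length-filter-tabulate P? (h ∘ suc)

length-filter-cartesianProduct : ∀ {A B : Set} {P : A × B → Set} (P? : Decidable P) {m}
  (f : Fin m → A) (ys : List B) →
  length (filter P? (cartesianProduct (tabulate f) ys)) ≡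
  ∑[ i < m ] length (filter P? (map (f i ,_) ys))
length-filter-cartesianProduct P? {zero} f ys = refl
length-filter-cartesianProduct P? {suc m} f ys = begin
  length (filter P? (map (f zero ,_) ys ++ cartesianProduct (tabulate (f ∘ suc)) ys))
    ≡⟨ cong length (filter-++ P? (map (f zero ,_) ys) _) ⟩
  length (filter P? (map (f zero ,_) ys) ++ filter P? (cartesianProduct (tabulate (f ∘ suc)) ys))
    ≡⟨ length-++ (filter P? (map (f zero ,_) ys)) ⟩
  length (filter P? (map (f zero ,_) ys)) + length (filter P? (cartesianProduct (tabulate (f ∘ suc)) ys))
    ≡⟨ cong (length (filter P? (map (f zero ,_) ys)) +_) (length-filter-cartesianProduct P? (f ∘ suc) ys) ⟩
  length (filter P? (map (f zero ,_) ys)) + ∑[ i < m ] length (filter P? (map (f (suc i) ,_) ys)) ∎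
  where open ≡-Reasoning

sum-single : ∀ {n} (f : Fin n → ℕ) p → (∀ j → j ≢ p → f j ≡ 0) → sum f ≡ f p
sum-single {suc n} f p vanish = begin
  sum f                     ≡⟨ sum-remove {i = p} f ⟩
  f p + sum (f ∘ punchIn p) ≡⟨ cong (f p +_) (sum-cong-≗ λ j → vanish (punchIn p j) (punchInᵢ≢i p j)) ⟩
  f p + sum {n} (λ _ → 0)   ≡⟨ cong (f p +_) (sum-replicate-zero n) ⟩
  f p + 0                   ≡⟨ +-identityʳ (f p) ⟩
  f p                       ∎
  where open ≡-Reasoning

isEdge? : ∀ {n} (G : FinGraph n) (i j : Fin n) → Dec (toℕ i < toℕ j × adj G i j)
isEdge? G i j = (toℕ i <? toℕ j) ×-dec adj? G i j

edgeIndicator : ∀ {n} (G : FinGraph n) (i j : Fin n) → ℕ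
edgeIndicator G i j = indicator (isEdge? G i j)

edgeCount-sum : ∀ {n} (G : FinGraph n) → edgeCount G ≡ ∑[ i < n ] ∑[ j < n ] edgeIndicator G i j
edgeCount-sum {n} G =
  trans (length-filter-cartesianProduct P? id (allFin n))
        (sum-cong-≗ λ i → trans (cong (length ∘ filter P?) (map-tabulate id (i ,_)))
                                (length-filter-tabulate P? (i ,_)))
  where
  P? = λ (e : Fin n × Fin n) → isEdge? G (proj₁ e) (proj₂ e)

edgeIndicator-diagonal : ∀ {n} (G : FinGraph n) i → edgeIndicator G i i ≡ 0
edgeIndicator-diagonal G i = indicator-no (λ (i<i , _) → <-irrefl refl i<i) (isEdge? G i i)

edgeIndicator-non-adjacent : ∀ {n} (G : FinGraph n) {i j} → ¬ adj G i j → edgeIndicator G i j ≡ 0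
edgeIndicator-non-adjacent G {i} {j} ¬ij = indicator-no (¬ij ∘ proj₂) (isEdge? G i j)

edgeIndicator-edge : ∀ {n} (G : FinGraph n) {i j} → adj G i j →
  edgeIndicator G i j + edgeIndicator G j i ≡ 1
edgeIndicator-edge G {i} {j} ij with <-cmp (toℕ i) (toℕ j)
... | tri< i<j _ j≮i = cong₂ _+_ (indicator-yes (i<j , ij) (isEdge? G i j))
                                 (indicator-no (j≮i ∘ proj₁) (isEdge? G j i))
... | tri≈ _ i≡j _ = contradiction (≡.subst (adj G i) (≡.sym (toℕ-injective i≡j)) ij) (irrefl G i)
... | tri> i≮j _ j<i = cong₂ _+_ (indicator-no (i≮j ∘ proj₁) (isEdge? G i j))
                                 (indicator-yes (j<i , sym G i j ij) (isEdge? G j i))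

punchIn-<⇔ : ∀ {n} (ℓ : Fin (suc n)) (i j : Fin n) →
  toℕ (punchIn ℓ i) < toℕ (punchIn ℓ j) ⇔ toℕ i < toℕ j
punchIn-<⇔ ℓ i j = mk⇔
  (λ lt → ≰⇒> λ j≤i → <⇒≱ lt (punchIn-mono-≤ ℓ j i j≤i))
  (λ lt → ≰⇒> λ j≤i → <⇒≱ lt (punchIn-cancel-≤ ℓ j i j≤i))

edgeIndicator-delete : ∀ {n} (G : FinGraph (suc n)) ℓ (i j : Fin n) →
  edgeIndicator G (punchIn ℓ i) (punchIn ℓ j) ≡ edgeIndicator (deleteVertex G ℓ) i j
edgeIndicator-delete G ℓ i j =
  indicator-⇔ (punchIn-<⇔ ℓ i j ×-⇔ Identity.⇔-id _) (isEdge? G _ _) (isEdge? (deleteVertex G ℓ) i j)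

module LeafDeletion {n} (T : FinGraph (suc n)) (leaf : Leaf T) where

  open Leaf leaf

  T⁻ : FinGraph n
  T⁻ = deleteVertex T ℓ

  private
    G = toGraph T
    G⁻ = toGraph T⁻

  -- A walk of T between vertices other than ℓ can only enter ℓ to bounce back to
  -- its neighbour; cutting out these detours gives a walk of T − ℓ that is no longer.
  shortcut : ∀ {x y L} → Walk G x y L → ∀ {u v} → x ≡ punchIn ℓ u → y ≡ punchIn ℓ v →
    Σ ℕ λ L′ → L′ ≤ L × Walk G⁻ u v L′
  shortcut here refl u≡v = 0 , z≤n , subst (λ v → Walk G⁻ _ v 0) (punchIn-injective ℓ _ _ u≡v) here
  shortcut (step {w = z} e w) refl y≡ with punched ℓ z
  ... | kept z′ with L′ , L′≤ , w′ ← shortcut w refl y≡ = suc L′ , s≤s L′≤ , step e w′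
  shortcut (step e here) refl ℓ≡ | hole = contradiction (≡.sym ℓ≡) (punchInᵢ≢i ℓ _)
  shortcut (step e (step {w = z} e′ w)) refl y≡ | hole
    with L′ , L′≤ , w′ ← shortcut w (trans (unique z e′) (≡.sym (unique _ (sym T _ ℓ e)))) y≡ =
    L′ , ≤-trans L′≤ (≤-trans (n≤1+n _) (n≤1+n _)) , w′

  dist-delete : ∀ {u v d} → Dist G⁻ u v d ⇔ Dist G (punchIn ℓ u) (punchIn ℓ v) d
  dist-delete {u} {v} {d} = mk⇔ to from
    where
    to : Dist G⁻ u v d → Dist G (punchIn ℓ u) (punchIn ℓ v) d
    to (w , minimal) = lift-walk T ℓ w , λ L w′ →
      let L′ , L′≤L , w″ = shortcut w′ refl refl in ≤-trans (minimal L′ w″) L′≤L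
    from : Dist G (punchIn ℓ u) (punchIn ℓ v) d → Dist G⁻ u v d
    from (w , minimal) =
      let L′ , L′≤d , w′ = shortcut w refl refl
      in subst (Walk G⁻ u v) (≤-antisym L′≤d (minimal L′ (lift-walk T ℓ w′))) w′ ,
         λ L w″ → minimal L (lift-walk T ℓ w″)

  -- Every walk out of ℓ passes through its neighbour.
  dist-from-leaf : ∀ {v d} → Dist G (punchIn ℓ p) (punchIn ℓ v) d → Dist G ℓ (punchIn ℓ v) (suc d)
  dist-from-leaf {v} {d} (w , minimal) = step edge w , λ L w′ → longer w′ refl
    where
    longer : ∀ {x L} → Walk G x (punchIn ℓ v) L → x ≡ ℓ → suc d ≤ L
    longer here v≡ℓ = contradiction v≡ℓ (punchInᵢ≢i ℓ v)
    longer (step {w = z} e w′) refl = s≤s (minimal _ (subst (λ z → Walk G z _ _) (unique z e) w′))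

  dist-leaf-edge : Dist G ℓ (punchIn ℓ p) 1
  dist-leaf-edge = dist-from-leaf dist-refl

  -- A walk avoiding ℓ survives in T − ℓ, so T − ℓ is still connected.
  tree-delete : IsTree T → IsTree T⁻
  tree-delete (connected , acyclic) = connected⁻ , acyclic-delete T ℓ acyclic
    where
    connected⁻ : Connected G⁻
    connected⁻ u v = let _ , w = connected (punchIn ℓ u) (punchIn ℓ v)
                         L′ , _ , w′ = shortcut w refl refl in L′ , w′

  -- Deleting a leaf deletes exactly one edge: split off the row and column of ℓ,
  -- where only the neighbour contributes.
  edgeCount-delete : edgeCount T ≡ suc (edgeCount T⁻)
  edgeCount-delete = begin
    edgeCount T
      ≡⟨ edgeCount-sum T ⟩
    ∑[ i < suc n ] ∑[ j < suc n ] e i j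
      ≡⟨ sum-remove {i = ℓ} (λ i → ∑[ j < suc n ] e i j) ⟩
    ∑[ j < suc n ] e ℓ j + ∑[ i < n ] ∑[ j < suc n ] e (punchIn ℓ i) j
      ≡⟨ cong₂ _+_ (sum-remove {i = ℓ} (e ℓ)) (sum-cong-≗ λ i → sum-remove {i = ℓ} (e (punchIn ℓ i))) ⟩
    (e ℓ ℓ + ∑[ j < n ] e ℓ (punchIn ℓ j)) +
      ∑[ i < n ] (e (punchIn ℓ i) ℓ + ∑[ j < n ] e (punchIn ℓ i) (punchIn ℓ j))
      ≡⟨ cong₂ _+_ (cong₂ _+_ (edgeIndicator-diagonal T ℓ) row) (∑-distrib-+ (λ i → e (punchIn ℓ i) ℓ) _) ⟩
    e ℓ (punchIn ℓ p) +
      (∑[ i < n ] e (punchIn ℓ i) ℓ + ∑[ i < n ] ∑[ j < n ] e (punchIn ℓ i) (punchIn ℓ j))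
      ≡⟨ cong (e ℓ (punchIn ℓ p) +_) (cong₂ _+_ column rest) ⟩
    e ℓ (punchIn ℓ p) + (e (punchIn ℓ p) ℓ + edgeCount T⁻)
      ≡⟨ ≡.sym (+-assoc (e ℓ (punchIn ℓ p)) _ _) ⟩
    (e ℓ (punchIn ℓ p) + e (punchIn ℓ p) ℓ) + edgeCount T⁻
      ≡⟨ cong (_+ edgeCount T⁻) (edgeIndicator-edge T edge) ⟩
    suc (edgeCount T⁻) ∎
    where
    open ≡-Reasoning
    e = edgeIndicator T
    not-neighbour : ∀ j → j ≢ p → ¬ adj T ℓ (punchIn ℓ j)
    not-neighbour j j≢p ℓj = j≢p (punchIn-injective ℓ _ _ (unique _ ℓj))
    row : ∑[ j < n ] e ℓ (punchIn ℓ j) ≡ e ℓ (punchIn ℓ p)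
    row = sum-single (e ℓ ∘ punchIn ℓ) p
      (λ j j≢p → edgeIndicator-non-adjacent T (not-neighbour j j≢p))
    column : ∑[ i < n ] e (punchIn ℓ i) ℓ ≡ e (punchIn ℓ p) ℓ
    column = sum-single (λ i → e (punchIn ℓ i) ℓ) p
      (λ i i≢p → edgeIndicator-non-adjacent T (not-neighbour i i≢p ∘ sym T _ ℓ))
    rest : ∑[ i < n ] ∑[ j < n ] e (punchIn ℓ i) (punchIn ℓ j) ≡ edgeCount T⁻
    rest = trans (sum-cong-≗ λ i → sum-cong-≗ λ j → edgeIndicator-delete T ℓ i j) (≡.sym (edgeCount-sum T⁻))

-- Lower bound: Hamming labellings of a tree need |E(T)| coordinates.

module _ {n} (T : FinGraph (suc n)) (leaf : Leaf T) where

  open Leaf leaf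
  open LeafDeletion T leaf

  private
    G = toGraph T
    p̂ = punchIn ℓ p

  -- A Hamming labelling of T needs a coordinate for the leaf edge; every other
  -- vertex agrees with the neighbour there, so dropping it labels T − ℓ.
  drop-leaf-coordinate : ∀ {k} (F : Fin (suc n) → Vec Bool (suc k)) → IsHammingLabelling G F →
    Σ (Fin n → Vec Bool k) (IsHammingLabelling (toGraph T⁻))
  drop-leaf-coordinate F F-dist = F⁻ , λ u v →
    Equivalence.from dist-delete (subst (Dist G (punchIn ℓ u) (punchIn ℓ v)) (drop u v) (F-dist _ _))
    where
    leaf-coordinate : Σ (Fin (suc _)) λ c → removeAt (F ℓ) c ≡ removeAt (F p̂) c
    leaf-coordinate = hamming-one (F ℓ) (F p̂) (dist-unique (F-dist ℓ p̂) dist-leaf-edge)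
    c = proj₁ leaf-coordinate
    F⁻ : Fin n → Vec Bool _
    F⁻ u = removeAt (F (punchIn ℓ u)) c
    -- d(ℓ, u) = 1 + d(p, u) forces F u to agree with F p at c.
    agree : ∀ u → lookup (F p̂) c ≡ lookup (F (punchIn ℓ u)) c
    agree u = dif-step (lookup (F ℓ) c) (lookup (F p̂) c) (lookup (F (punchIn ℓ u)) c)
      (+-cancelʳ-≡ (hamming (removeAt (F p̂) c) (F⁻ u)) _ _ (begin
        dif (lookup (F ℓ) c) (lookup (F (punchIn ℓ u)) c) + hamming (removeAt (F p̂) c) (F⁻ u)
          ≡⟨ cong (λ r → dif (lookup (F ℓ) c) (lookup (F (punchIn ℓ u)) c) + hamming r (F⁻ u))
                  (≡.sym (proj₂ leaf-coordinate)) ⟩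
        dif (lookup (F ℓ) c) (lookup (F (punchIn ℓ u)) c) + hamming (removeAt (F ℓ) c) (F⁻ u)
          ≡⟨ ≡.sym (hamming-removeAt (F ℓ) (F (punchIn ℓ u)) c) ⟩
        hamming (F ℓ) (F (punchIn ℓ u))
          ≡⟨ dist-unique (F-dist ℓ (punchIn ℓ u)) (dist-from-leaf (F-dist p̂ (punchIn ℓ u))) ⟩
        suc (hamming (F p̂) (F (punchIn ℓ u)))
          ≡⟨ cong suc (hamming-removeAt (F p̂) (F (punchIn ℓ u)) c) ⟩
        suc (dif (lookup (F p̂) c) (lookup (F (punchIn ℓ u)) c) + hamming (removeAt (F p̂) c) (F⁻ u)) ∎))
      where open ≡-Reasoning
    drop : ∀ u v → hamming (F (punchIn ℓ u)) (F (punchIn ℓ v)) ≡ hamming (F⁻ u) (F⁻ v)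
    drop u v = trans (hamming-removeAt (F (punchIn ℓ u)) (F (punchIn ℓ v)) c)
      (cong (_+ hamming (F⁻ u) (F⁻ v))
        (trans (cong₂ dif (≡.sym (agree u)) (≡.sym (agree v))) (dif-self (lookup (F p̂) c))))

  dimension-step : ∀ {k} (F : Fin (suc n) → Vec Bool k) → IsHammingLabelling G F →
    (∀ {k′} (F⁻ : Fin n → Vec Bool k′) → IsHammingLabelling (toGraph T⁻) F⁻ → edgeCount T⁻ ≤ k′) →
    edgeCount T ≤ k
  dimension-step {zero} F F-dist _ =
    contradiction (trans (≡.sym (hamming-empty (F ℓ) (F p̂))) (dist-unique (F-dist ℓ p̂) dist-leaf-edge)) λ ()
    where
    hamming-empty : (x y : Vec Bool 0) → hamming x y ≡ 0
    hamming-empty [] [] = refl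
  dimension-step {suc k} F F-dist bound⁻ =
    subst (_≤ suc k) (≡.sym edgeCount-delete) (s≤s (bound⁻ (proj₁ labelling⁻) (proj₂ labelling⁻)))
    where labelling⁻ = drop-leaf-coordinate F F-dist

labelling-dimension : ∀ n (T : FinGraph n) → IsTree T →
  ∀ {k} (F : Fin n → Vec Bool k) → IsHammingLabelling (toGraph T) F → edgeCount T ≤ k
labelling-dimension zero T _ _ _ = z≤n
labelling-dimension (suc zero) T _ _ _ = z≤n
labelling-dimension (suc (suc m)) T tree F F-dist =
  dimension-step T leaf F F-dist (labelling-dimension (suc m) T⁻ (tree-delete tree))
  where
  leaf = proj₁ (leaf-avoiding T tree zero)
  open LeafDeletion T leaf

-- Upper bound: trees have Fibonacci labellings with |E(T)| coordinates.

record RootedFibLabelling {n} (T : FinGraph n) (k : ℕ) (q : Fin n) : Set where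
  field
    label     : Fin n → V (Γ k)
    distances : IsHammingLabelling (toGraph T) (proj₁ ∘ label)
    root-slot : HasSlot (proj₁ (label q))

module _ {n} (T : FinGraph (suc n)) (leaf : Leaf T) where

  open Leaf leaf
  open LeafDeletion T leaf

  private
    G = toGraph T

  -- Re-attach the leaf: append a new coordinate at the neighbour's slot, set to 1 at
  -- ℓ (a copy of the neighbour's label) and to 0 elsewhere; any root q ≠ ℓ keeps a slot.
  attach-leaf : ∀ {k} → RootedFibLabelling T⁻ k p → ∀ q → ℓ ≢ q → RootedFibLabelling T (suc k) q
  attach-leaf {k} R q ℓ≢q = record
    { label     = label′ ∘ punched ℓ
    ; distances = λ u v → distances′ (punched ℓ u) (punched ℓ v)
    ; root-slot = slot (punched ℓ q) ℓ≢q
    }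
    where
    open RootedFibLabelling R
    i = proj₁ root-slot
    f : Fin n → Vec Bool k
    f = proj₁ ∘ label
    label′ : ∀ {x} → Punched ℓ x → V (Γ (suc k))
    label′ hole     = insertAt (f p) i true , proj₂ root-slot
    label′ (kept u) = insertAt (f u) i false , insert-false (f u) i (proj₂ (label u))
    distances′ : ∀ {x y} (x̂ : Punched ℓ x) (ŷ : Punched ℓ y) →
      Dist G x y (hamming (proj₁ (label′ x̂)) (proj₁ (label′ ŷ)))
    distances′ hole hole = subst (Dist G ℓ ℓ) (≡.sym (hamming-self (insertAt (f p) i true))) dist-refl
    distances′ hole (kept v) =
      subst (Dist G ℓ (punchIn ℓ v)) (≡.sym (hamming-insertAt (f p) (f v) i true false))
        (dist-from-leaf (Equivalence.to dist-delete (distances p v)))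
    distances′ (kept u) hole =
      subst (Dist G (punchIn ℓ u) ℓ) (hamming-sym (proj₁ (label′ hole)) (proj₁ (label′ (kept u))))
        (dist-sym (sym T _ _) (distances′ hole (kept u)))
    distances′ (kept u) (kept v) =
      subst (Dist G (punchIn ℓ u) (punchIn ℓ v)) (≡.sym (hamming-insertAt (f u) (f v) i false false))
        (Equivalence.to dist-delete (distances u v))
    slot : ∀ {x} (x̂ : Punched ℓ x) → ℓ ≢ x → HasSlot (proj₁ (label′ x̂))
    slot hole ℓ≢ℓ = contradiction refl ℓ≢ℓ
    slot (kept u) _ = insert-false-slot (f u) i (proj₂ (label u))

rooted-fib-labelling : ∀ n (T : FinGraph (suc n)) → IsTree T → ∀ q → RootedFibLabelling T (edgeCount T) q
rooted-fib-labelling zero T _ q = record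
  { label = λ _ → [] , tt ; distances = λ { zero zero → dist-refl } ; root-slot = zero , tt }
rooted-fib-labelling (suc m) T tree q =
  subst (λ k → RootedFibLabelling T k q) (≡.sym edgeCount-delete)
    (attach-leaf T leaf (rooted-fib-labelling m T⁻ (tree-delete tree) (Leaf.p leaf)) q ℓ≢q)
  where
  found = leaf-avoiding T tree q
  leaf = proj₁ found
  ℓ≢q = proj₂ found
  open LeafDeletion T leaf

fib-labelling : ∀ n (T : FinGraph n) → IsTree T →
  Σ (Fin n → V (Γ (edgeCount T))) λ f → IsHammingLabelling (toGraph T) (proj₁ ∘ f)
fib-labelling zero T _ = (λ ()) , λ ()
fib-labelling (suc n) T tree = label , distances
  where open RootedFibLabelling (rooted-fib-labelling n T tree zero)

corollary3p6 : ∀ (n : ℕ) (T : FinGraph n) → IsTree T →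
    FdimIs (toGraph T) (edgeCount T) × IdimIs (toGraph T) (edgeCount T)
corollary3p6 n T tree =
  (labelling⇒embedding proj₁ Γ-metric f f-dist , λ j e → minimal (embedding⇒labelling proj₁ Γ-metric e)) ,
  (labelling⇒embedding id Q-metric (proj₁ ∘ f) f-dist , λ j e → minimal (embedding⇒labelling id Q-metric e))
  where
  f = proj₁ (fib-labelling n T tree)
  f-dist = proj₂ (fib-labelling n T tree)
  minimal : ∀ {j} → Σ (Fin n → Vec Bool j) (IsHammingLabelling (toGraph T)) → edgeCount T ≤ j
  minimal (F , F-dist) = labelling-dimension n T tree F F-dist
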